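{- The curve $$\mathcal{C}_{\pi/3,\pi/2}:\quad X^4 - X^3 + 2X^2 - X + 1 = Y^2$$ has infinitely many rational points $(X,Y)\in\mathbb{Q}^2$.
   Context: This curve arises from the pair of equations $x^2-xy+y^2=z_1^2$ and $x^2+y^2=z_2^2$ (law of cosines for triangles with two sides $x,y$ enclosing angles $\pi/3$ and $\pi/2$) by multiplying them and setting $X=x/y$, $Y=z_1z_2/y^2$. -}

module Defs where

open import Data.Rational using (ℚ; _+_; _*_; _-_; 1ℚ)
open import Data.Rational.Literals using ()
open import Data.Product using (_×_; _,_; ∃)
open import Data.List using (List)
open import Data.List.Membership.Propositional using (_∈_)
open import Relation.Binary.PropositionalEquality using (_≡_)
open import Relation.Nullary using (¬_)

2ℚ : ℚ
2ℚ = 1ℚ + 1ℚ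

OnCurve : ℚ × ℚ → Set
OnCurve (X , Y) =
  X * X * X * X - X * X * X + 2ℚ * (X * X) - X + 1ℚ ≡ Y * Y

Infinite : (ℚ × ℚ → Set) → Set
Infinite P = (L : List (ℚ × ℚ)) → ∃ λ p → P p × ¬ (p ∈ L)

-- The quartic is the image of the elliptic curve y² = x³ + 2x² − 3x − 6 under an explicit
-- rational map, and its points are produced by repeatedly doubling one point of that curve.
-- In weighted integer coordinates x = m / e², y = n / e³, start from (m, e, n) = (193, 4, 2865):
-- doubling keeps m and n odd and replaces e by 2ne, so after k doublings 2ᵏ⁺² exactly divides e.
-- The X-coordinate of the image point has an odd denominator and a numerator divisible by e,
-- so its reduced numerator is a nonzero multiple of 2ᵏ. Choosing k so that 2ᵏ exceeds every
-- numerator in a given finite list yields a point outside the list.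

module Submission where

open import Defs

open import Algebra.Bundles.Raw using (RawRing)
open import Data.Nat as ℕ using (ℕ; zero; suc; _^_)
import Data.Nat.Properties as ℕ
open import Data.Nat.GeneralisedArithmetic using (fold)
open import Data.Integer as ℤ using (ℤ; +_; 0ℤ; 1ℤ; ∣_∣)
import Data.Integer.Properties as ℤ
open import Data.Integer.DivMod using (_%ℕ_; _/ℕ_; a≡a%ℕn+[a/ℕn]*n; n%ℕd<d)
open import Data.Integer.Divisibility.Signed
  using (_∣_; divides; ∣-trans; ∣⇒∣ᵤ; *-monoʳ-∣; *-cancelˡ-∣)
import Data.Nat.Divisibility as ℕ using (∣⇒≤)
open import Data.Rational as ℚ using (ℚ; 0ℚ; 1ℚ; ↥_; ↧_; mkℚ; toℚᵘ)
import Data.Rational.Properties as ℚ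
open import Data.Rational.Unnormalised as ℚᵘ using (mkℚᵘ; *≡*) renaming (_≃_ to _≃ᵘ_)
import Data.Rational.Unnormalised.Properties as ℚᵘ
open import Data.List using (List; []; _∷_)
open import Data.List.Membership.Propositional using (_∈_)
open import Data.List.Relation.Unary.Any using (here; there)
open import Data.Product using (∃; _×_; _,_; proj₁)
open import Data.Sum using (_⊎_; inj₁; inj₂; [_,_]′)
open import Data.Empty using (⊥-elim)
open import Function using (_∘_)
open import Level using (0ℓ)
open import Relation.Binary.PropositionalEquality
open import Relation.Nullary using (¬_)
open import Relation.Nullary.Decidable using (dec⇒maybe)
import Tactic.RingSolver.Core.AlmostCommutativeRing as ACR
open import Tactic.RingSolver.Core.Expression using (Expr; Κ; _⊕_; _⊗_; ⊝_)
import Tactic.RingSolver.NonReflective as NonReflective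

-- Stated over an arbitrary raw ring so that the same formulas can be read in ℤ, in ℚ,
-- and as ring-solver syntax.
module Polynomials (R : RawRing 0ℓ 0ℓ) (fromℕ : ℕ → RawRing.Carrier R) where
  open RawRing R using (Carrier; _+_; _*_; -_)

  private
    infixl 6 _-_
    _-_ : Carrier → Carrier → Carrier
    x - y = x + - y

    #_ : ℕ → Carrier
    # k = fromℕ k

  -- y² = x³ + 2x² − 3x − 6 in the weighted coordinates x = m / e², y = n / e³.
  weierstrass : Carrier → Carrier → Carrier
  weierstrass m e =
    m * m * m + # 2 * (m * m * e * e) - # 3 * (m * e * e * e * e) - # 6 * (e * e * e * e * e * e)

  slope : Carrier → Carrier → Carrier
  slope m e = # 3 * (m * m) + # 4 * (m * e * e) - # 3 * (e * e * e * e)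

  doubleM : Carrier → Carrier → Carrier → Carrier
  doubleM m e n = slope m e * slope m e - # 8 * (n * n * (m + e * e))

  doubleE : Carrier → Carrier → Carrier → Carrier
  doubleE m e n = # 2 * (n * e)

  doubleN : Carrier → Carrier → Carrier → Carrier
  doubleN m e n = slope m e * (# 4 * (n * n * m) - doubleM m e n) - # 8 * (n * n * n * n)

  quartic : Carrier → Carrier → Carrier
  quartic p q =
    p * p * p * p - p * p * p * q + # 2 * (p * p * q * q) - p * q * q * q + q * q * q * q

  -- The map to the quartic curve at a point with e = 4G: X = xNumerator / xDenominator,
  -- Y = yNumerator / xDenominator².
  xNumerator : Carrier → Carrier → Carrier
  xNumerator m G = # 8 * (G * (m + # 28 * (G * G)))

  xDenominator : Carrier → Carrier → Carrier → Carrier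
  xDenominator m G n = n + # 2 * (m * G) + # 64 * (G * G * G)

  yNumerator : Carrier → Carrier → Carrier → Carrier
  yNumerator m G n = # 2 * (m * s * s) + # 4 * (G * s * z) - z * z
    where
    s = m + # 28 * (G * G)
    z = xDenominator m G n

expressions : RawRing 0ℓ 0ℓ → ℕ → RawRing 0ℓ 0ℓ
expressions R k = record
  { Carrier = Expr (RawRing.Carrier R) k
  ; _≈_     = _≡_
  ; _+_     = _⊕_
  ; _*_     = _⊗_
  ; -_      = ⊝_
  ; 0#      = Κ (RawRing.0# R)
  ; 1#      = Κ (RawRing.1# R)
  }

open Polynomials ℤ.+-*-rawRing +_
module ℤSyntax (k : ℕ) = Polynomials (expressions ℤ.+-*-rawRing k) (Κ ∘ +_)

ℚ-fromℕ : ℕ → ℚ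
ℚ-fromℕ k = + k ℚ./ 1

module ℚPolynomials = Polynomials ℚ.+-*-rawRing ℚ-fromℕ
module ℚSyntax (k : ℕ) = Polynomials (expressions ℚ.+-*-rawRing k) (Κ ∘ ℚ-fromℕ)

-- Imported only here: inside Polynomials these names are the raw ring's operations.
open import Data.Integer using (_+_; _*_; _-_; -_)
open import Data.Integer.Tactic.RingSolver using (ring; solve; solve-∀)
open NonReflective ring using (_⊜_) renaming (solve to solveℤ)

ℚ-ring : ACR.AlmostCommutativeRing 0ℓ 0ℓ
ℚ-ring = ACR.fromCommutativeRing ℚ.+-*-commutativeRing (λ x → dec⇒maybe (0ℚ ℚ.≟ x))

module ℚSolver = NonReflective ℚ-ring

Even Odd : ℤ → Set
Even x = ∃ λ t → x ≡ + 2 * t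
Odd x = ∃ λ t → x ≡ + 2 * t + 1ℤ

even* : ∀ {x} → Even x → ∀ y → Even (x * y)
even* (t , refl) y = t * y , solve (t ∷ y ∷ [])

*-even : ∀ x {y} → Even y → Even (x * y)
*-even x {y} even-y = subst Even (ℤ.*-comm y x) (even* even-y x)

odd*odd : ∀ {x y} → Odd x → Odd y → Odd (x * y)
odd*odd (a , refl) (b , refl) = + 2 * a * b + a + b , solve (a ∷ b ∷ [])

odd+even : ∀ {x y} → Odd x → Even y → Odd (x + y)
odd+even (a , refl) (b , refl) = a + b , solve (a ∷ b ∷ [])

odd-even : ∀ {x y} → Odd x → Even y → Odd (x - y)
odd-even (a , refl) (b , refl) = a - b , solve (a ∷ b ∷ [])

even-odd : ∀ {x y} → Even x → Odd y → Odd (x - y)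
even-odd (a , refl) (b , refl) = a - b - 1ℤ , solve (a ∷ b ∷ [])

even⇒¬odd : ∀ {x} → Even x → ¬ Odd x
even⇒¬odd (a , refl) (b , 2a≡2b+1)
  with ℕ.m*n≡1⇒m≡1 2 ∣ a - b ∣ (trans (sym (ℤ.abs-* (+ 2) (a - b))) (cong ∣_∣ 2[a-b]≡1))
  where
  2[a-b]≡1 : + 2 * (a - b) ≡ 1ℤ
  2[a-b]≡1 = begin
    + 2 * (a - b)          ≡⟨ solve (a ∷ b ∷ []) ⟩
    + 2 * a - + 2 * b      ≡⟨ cong (_- + 2 * b) 2a≡2b+1 ⟩
    + 2 * b + 1ℤ - + 2 * b ≡⟨ solve (b ∷ []) ⟩
    1ℤ                     ∎
    where open ≡-Reasoning
... | ()

odd⇒≢0 : ∀ {x} → Odd x → x ≢ 0ℤ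
odd⇒≢0 odd-x refl = even⇒¬odd (0ℤ , refl) odd-x

even⊎odd : ∀ x → Even x ⊎ Odd x
even⊎odd x with x %ℕ 2 | a≡a%ℕn+[a/ℕn]*n x 2 | n%ℕd<d x 2
... | 0 | eq | _ = inj₁ (x /ℕ 2 , trans eq (trans (ℤ.+-identityˡ _) (ℤ.*-comm (x /ℕ 2) (+ 2))))
... | 1 | eq | _ = inj₂ (x /ℕ 2 , trans eq (trans (ℤ.+-comm 1ℤ (x /ℕ 2 * + 2))
                                                   (cong (_+ 1ℤ) (ℤ.*-comm (x /ℕ 2) (+ 2)))))
... | suc (suc _) | _ | ℕ.s≤s (ℕ.s≤s ())

n<2^n : ∀ n → n ℕ.< 2 ^ n
n<2^n zero    = ℕ.s≤s ℕ.z≤n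
n<2^n (suc n) = ℕ.+-mono-≤ (ℕ.m^n>0 2 n) (ℕ.≤-trans (n<2^n n) (ℕ.m≤m+n (2 ^ n) 0))

2^suc : ∀ k → + (2 ^ suc k) ≡ + 2 * + (2 ^ k)
2^suc k = ℤ.pos-* 2 (2 ^ k)

2^k≢0 : ∀ k → + (2 ^ k) ≢ 0ℤ
2^k≢0 k = ℕ.>⇒≢ (ℕ.m^n>0 2 k) ∘ ℤ.+-injective

*-≢0 : ∀ i j → i ≢ 0ℤ → j ≢ 0ℤ → i * j ≢ 0ℤ
*-≢0 i _ i≢0 j≢0 = [ i≢0 , j≢0 ]′ ∘ ℤ.i*j≡0⇒i≡0∨j≡0 i

2^k∣x*odd⇒2^k∣x : ∀ k {x o} → Odd o → + (2 ^ k) ∣ x * o → + (2 ^ k) ∣ x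
2^k∣x*odd⇒2^k∣x zero {x} _ _ = divides x (sym (ℤ.*-identityʳ x))
2^k∣x*odd⇒2^k∣x (suc k) {x} {o} odd-o 2^[1+k]∣xo with even⊎odd x
... | inj₂ odd-x = ⊥-elim (even⇒¬odd (q , trans eq (ℤ.*-comm q (+ 2))) (odd*odd odd-x odd-o))
  where
  2∣2^[1+k] : + 2 ∣ + (2 ^ suc k)
  2∣2^[1+k] = divides (+ (2 ^ k)) (trans (2^suc k) (ℤ.*-comm (+ 2) (+ (2 ^ k))))
  open _∣_ (∣-trans 2∣2^[1+k] 2^[1+k]∣xo) renaming (quotient to q; equality to eq)
... | inj₁ (t , refl) =
  subst (_∣ + 2 * t) (sym (2^suc k))
    (*-monoʳ-∣ (+ 2) (2^k∣x*odd⇒2^k∣x k odd-o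
      (*-cancelˡ-∣ (+ 2) (subst₂ _∣_ (2^suc k) (ℤ.*-assoc (+ 2) t o) 2^[1+k]∣xo))))

2^k≤∣x∣ : ∀ k {x q w d} → Odd q → w ≢ 0ℤ → d ≢ 0ℤ →
          x * q ≡ + (2 ^ k) * w * d → 2 ^ k ℕ.≤ ∣ x ∣
2^k≤∣x∣ k {x} {q} {w} {d} odd-q w≢0 d≢0 xq≡2^kwd =
  ℕ.∣⇒≤ {{ℕ.≢-nonZero (x≢0 ∘ ℤ.∣i∣≡0⇒i≡0)}} (∣⇒∣ᵤ (2^k∣x*odd⇒2^k∣x k {x} odd-q 2^k∣xq))
  where
  2^k∣xq : + (2 ^ k) ∣ x * q
  2^k∣xq = divides (w * d) (trans xq≡2^kwd (reorder (+ (2 ^ k)) w d))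
    where
    reorder : ∀ a b c → a * b * c ≡ b * c * a
    reorder = solve-∀
  x≢0 : x ≢ 0ℤ
  x≢0 refl = *-≢0 (+ (2 ^ k) * w) d (*-≢0 (+ (2 ^ k)) w (2^k≢0 k) w≢0) d≢0 (sym xq≡2^kwd)

i-j≡k*[l-m]⇒l≡m⇒i≡j : ∀ {i j l m} k → i - j ≡ k * (l - m) → l ≡ m → i ≡ j
i-j≡k*[l-m]⇒l≡m⇒i≡j {i} {j} {l} k eq refl = ℤ.i-j≡0⇒i≡j i j (begin
  i - j       ≡⟨ eq ⟩
  k * (l - l) ≡⟨ cong (k *_) (ℤ.+-inverseʳ l) ⟩
  k * 0ℤ      ≡⟨ ℤ.*-zeroʳ k ⟩
  0ℤ          ∎)
  where open ≡-Reasoning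

record Point : Set where
  constructor ⟨_,_,_⟩
  field m e n : ℤ

OnWeierstrass : Point → Set
OnWeierstrass ⟨ m , e , n ⟩ = n * n ≡ weierstrass m e

double : Point → Point
double ⟨ m , e , n ⟩ = ⟨ doubleM m e n , doubleE m e n , doubleN m e n ⟩

doubling-identity : ∀ m e n →
  doubleN m e n * doubleN m e n - weierstrass (doubleM m e n) (doubleE m e n)
    ≡ + 64 * (n * n * n * n * n * n) * (n * n - weierstrass m e)
doubling-identity = solveℤ 3 (λ m e n →
  S.doubleN m e n ⊗ S.doubleN m e n ⊕ ⊝ S.weierstrass (S.doubleM m e n) (S.doubleE m e n)
    ⊜ Κ (+ 64) ⊗ (n ⊗ n ⊗ n ⊗ n ⊗ n ⊗ n) ⊗ (n ⊗ n ⊕ ⊝ S.weierstrass m e)) refl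
  where module S = ℤSyntax 3

double-onWeierstrass : ∀ P → OnWeierstrass P → OnWeierstrass (double P)
double-onWeierstrass ⟨ m , e , n ⟩ =
  i-j≡k*[l-m]⇒l≡m⇒i≡j (+ 64 * (n * n * n * n * n * n)) (doubling-identity m e n)

Level : ℕ → Point → Set
Level k ⟨ m , e , n ⟩ = Odd m × Odd n × ∃ λ h → Odd h × e ≡ + 4 * (+ (2 ^ k) * h)

odd-slope : ∀ {m e} → Odd m → Even e → Odd (slope m e)
odd-slope {e = e} odd-m even-e =
  odd-even (odd+even (odd*odd (+ 1 , refl) (odd*odd odd-m odd-m)) (even* (+ 2 , refl) _))
           (*-even (+ 3) (even* (even* (even* even-e e) e) e))

double-level : ∀ {k} P → Level k P → Level (suc k) (double P)
double-level {k} ⟨ m , _ , n ⟩ (odd-m , odd-n , h , odd-h , refl) =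
  odd-M , odd-N , n * h , odd*odd odd-n odd-h , doubled-power
  where
  e = + 4 * (+ (2 ^ k) * h)
  odd-S = odd-slope odd-m (even* (+ 2 , refl) (+ (2 ^ k) * h))
  odd-M : Odd (doubleM m e n)
  odd-M = odd-even (odd*odd odd-S odd-S) (even* (+ 4 , refl) (n * n * (m + e * e)))
  odd-N : Odd (doubleN m e n)
  odd-N = odd-even (odd*odd odd-S (even-odd (even* (+ 2 , refl) (n * n * m)) odd-M))
                   (even* (+ 4 , refl) (n * n * n * n))
  doubled-power : doubleE m e n ≡ + 4 * (+ (2 ^ suc k) * (n * h))
  doubled-power =
    trans (reassociate n (+ (2 ^ k)) h) (cong (λ t → + 4 * (t * (n * h))) (sym (2^suc k)))
    where
    reassociate : ∀ n t h → + 2 * (n * (+ 4 * (t * h))) ≡ + 4 * (+ 2 * t * (n * h))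
    reassociate = solve-∀

base : Point
base = ⟨ + 193 , + 4 , + 2865 ⟩

pointAt : ℕ → Point
pointAt = fold base double

pointAt-onWeierstrass : ∀ k → OnWeierstrass (pointAt k)
pointAt-onWeierstrass zero    = refl
pointAt-onWeierstrass (suc k) = double-onWeierstrass (pointAt k) (pointAt-onWeierstrass k)

pointAt-level : ∀ k → Level k (pointAt k)
pointAt-level zero    = (+ 96 , refl) , (+ 1432 , refl) , + 1 , (0ℤ , refl) , refl
pointAt-level (suc k) = double-level {k} (pointAt k) (pointAt-level k)

quartic-identity : ∀ m G n →
  quartic (xNumerator m G) (xDenominator m G n) - yNumerator m G n * yNumerator m G n
    ≡ + 4 * (m + + 28 * (G * G)) * (m + + 28 * (G * G)) * (m + + 28 * (G * G))
        * (n * n - weierstrass m (+ 4 * G))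
quartic-identity = solveℤ 3 (λ m G n → let s = m ⊕ Κ (+ 28) ⊗ (G ⊗ G) in
  S.quartic (S.xNumerator m G) (S.xDenominator m G n) ⊕ ⊝ (S.yNumerator m G n ⊗ S.yNumerator m G n)
    ⊜ Κ (+ 4) ⊗ s ⊗ s ⊗ s ⊗ (n ⊗ n ⊕ ⊝ S.weierstrass m (Κ (+ 4) ⊗ G))) refl
  where module S = ℤSyntax 3

onWeierstrass⇒quartic : ∀ {m G n} → OnWeierstrass ⟨ m , + 4 * G , n ⟩ →
  quartic (xNumerator m G) (xDenominator m G n) ≡ yNumerator m G n * yNumerator m G n
onWeierstrass⇒quartic {m} {G} {n} =
  i-j≡k*[l-m]⇒l≡m⇒i≡j (+ 4 * s * s * s) (quartic-identity m G n)
  where s = m + + 28 * (G * G)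

fromℤ : ℤ → ℚ
fromℤ i = i ℚ./ 1

toℚᵘ-fromℤ : ∀ i → toℚᵘ (fromℤ i) ≃ᵘ mkℚᵘ i 0
toℚᵘ-fromℤ i = ℚ.toℚᵘ-fromℚᵘ (mkℚᵘ i 0)

≃ᵘ⇒≡fromℤ : ∀ {x i} → toℚᵘ x ≃ᵘ mkℚᵘ i 0 → x ≡ fromℤ i
≃ᵘ⇒≡fromℤ {i = i} x≃i = ℚ.toℚᵘ-injective (ℚᵘ.≃-trans x≃i (ℚᵘ.≃-sym (toℚᵘ-fromℤ i)))

fromℤ-+ : ∀ i j → fromℤ (i + j) ≡ fromℤ i ℚ.+ fromℤ j
fromℤ-+ i j = sym (≃ᵘ⇒≡fromℤ {i = i + j} (ℚᵘ.≃-trans (ℚ.toℚᵘ-homo-+ (fromℤ i) (fromℤ j))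
  (ℚᵘ.≃-trans (ℚᵘ.+-cong (toℚᵘ-fromℤ i) (toℚᵘ-fromℤ j))
    (*≡* (cong (_* 1ℤ) (cong₂ _+_ (ℤ.*-identityʳ i) (ℤ.*-identityʳ j)))))))

fromℤ-* : ∀ i j → fromℤ (i * j) ≡ fromℤ i ℚ.* fromℤ j
fromℤ-* i j = sym (≃ᵘ⇒≡fromℤ {i = i * j} (ℚᵘ.≃-trans (ℚ.toℚᵘ-homo-* (fromℤ i) (fromℤ j))
  (ℚᵘ.*-cong (toℚᵘ-fromℤ i) (toℚᵘ-fromℤ j))))

fromℤ-neg : ∀ i → fromℤ (- i) ≡ ℚ.- fromℤ i
fromℤ-neg i = sym (≃ᵘ⇒≡fromℤ {i = - i} (ℚᵘ.≃-trans (ℚ.toℚᵘ-homo‿- (fromℤ i))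
  (ℚᵘ.-‿cong (toℚᵘ-fromℤ i))))

fromℤ-- : ∀ i j → fromℤ (i - j) ≡ fromℤ i ℚ.- fromℤ j
fromℤ-- i j = trans (fromℤ-+ i (- j)) (cong (fromℤ i ℚ.+_) (fromℤ-neg j))

fromℤ-*⁴ : ∀ a b c d → fromℤ (a * b * c * d) ≡ fromℤ a ℚ.* fromℤ b ℚ.* fromℤ c ℚ.* fromℤ d
fromℤ-*⁴ a b c d = trans (fromℤ-* (a * b * c) d) (cong (ℚ._* fromℤ d)
  (trans (fromℤ-* (a * b) c) (cong (ℚ._* fromℤ c) (fromℤ-* a b))))

fromℤ-quartic : ∀ p q → fromℤ (quartic p q) ≡ ℚPolynomials.quartic (fromℤ p) (fromℤ q)
fromℤ-quartic p q =
  trans (fromℤ-+ a₃ (q * q * q * q)) (cong₂ ℚ._+_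
    (trans (fromℤ-- a₂ (p * q * q * q)) (cong₂ ℚ._-_
      (trans (fromℤ-+ a₁ (+ 2 * (p * p * q * q))) (cong₂ ℚ._+_
        (trans (fromℤ-- (p * p * p * p) (p * p * p * q))
          (cong₂ ℚ._-_ (fromℤ-*⁴ p p p p) (fromℤ-*⁴ p p p q)))
        (trans (fromℤ-* (+ 2) (p * p * q * q)) (cong (ℚ-fromℕ 2 ℚ.*_) (fromℤ-*⁴ p p q q)))))
      (fromℤ-*⁴ p q q q)))
    (fromℤ-*⁴ q q q q))
  where
  a₁ = p * p * p * p - p * p * p * q
  a₂ = a₁ + + 2 * (p * p * q * q)
  a₃ = a₂ - p * q * q * q

fromℤ-≢0 : ∀ {i} → i ≢ 0ℤ → fromℤ i ≢ 0ℚ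
fromℤ-≢0 {i} i≢0 i≡0 with ℚᵘ.≃-trans (ℚᵘ.≃-sym (toℚᵘ-fromℤ i)) (ℚ.toℚᵘ-cong i≡0)
... | *≡* i*1≡0 = i≢0 (trans (sym (ℤ.*-identityʳ i)) i*1≡0)

↥x*q≡p*↧x : ∀ x {p q} → x ℚ.* fromℤ q ≡ fromℤ p → ↥ x * q ≡ p * ↧ x
↥x*q≡p*↧x x@(mkℚ a d _) {p} {q} xq≡p with xq≃p
  where
  xq≃p : toℚᵘ x ℚᵘ.* mkℚᵘ q 0 ≃ᵘ mkℚᵘ p 0
  xq≃p = ℚᵘ.≃-trans (ℚᵘ.*-congˡ {toℚᵘ x} (ℚᵘ.≃-sym (toℚᵘ-fromℤ q)))
           (ℚᵘ.≃-trans (ℚᵘ.≃-sym (ℚ.toℚᵘ-homo-* x (fromℤ q)))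
             (ℚᵘ.≃-trans (ℚ.toℚᵘ-cong xq≡p) (toℚᵘ-fromℤ p)))
... | *≡* aq*1≡p*[1+d*1] = trans (sym (ℤ.*-identityʳ (a * q)))
                                 (trans aq*1≡p*[1+d*1] (cong (λ k → p * + suc k) (ℕ.*-identityʳ d)))

onCurve-quotient : ∀ {p q r u} → q ℚ.* u ≡ 1ℚ → ℚPolynomials.quartic p q ≡ r ℚ.* r →
                   OnCurve (p ℚ.* u , r ℚ.* (u ℚ.* u))
onCurve-quotient {p} {q} {r} {u} qu≡1 quartic≡r² = begin
  X ℚ.* X ℚ.* X ℚ.* X ℚ.- X ℚ.* X ℚ.* X ℚ.+ 2ℚ ℚ.* (X ℚ.* X) ℚ.- X ℚ.+ 1ℚ
    ≡⟨ dehomogenise X ⟩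
  Q.quartic X 1ℚ
    ≡⟨ cong (Q.quartic X) qu≡1 ⟨
  Q.quartic X (q ℚ.* u)
    ≡⟨ homogeneous p q u ⟩
  Q.quartic p q ℚ.* u⁴
    ≡⟨ cong (ℚ._* u⁴) quartic≡r² ⟩
  r ℚ.* r ℚ.* u⁴
    ≡⟨ regroup r u ⟩
  r ℚ.* (u ℚ.* u) ℚ.* (r ℚ.* (u ℚ.* u))
    ∎
  where
  open ≡-Reasoning
  module Q = ℚPolynomials
  X = p ℚ.* u
  u⁴ = u ℚ.* u ℚ.* u ℚ.* u
  dehomogenise : ∀ x → x ℚ.* x ℚ.* x ℚ.* x ℚ.- x ℚ.* x ℚ.* x ℚ.+ 2ℚ ℚ.* (x ℚ.* x) ℚ.- x ℚ.+ 1ℚ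
                       ≡ Q.quartic x 1ℚ
  dehomogenise = ℚSolver.solve 1 (λ x →
    x ⊗ x ⊗ x ⊗ x ⊕ ⊝ (x ⊗ x ⊗ x) ⊕ Κ 2ℚ ⊗ (x ⊗ x) ⊕ ⊝ x ⊕ Κ 1ℚ ℚSolver.⊜ S.quartic x (Κ 1ℚ)) refl
    where module S = ℚSyntax 1
  homogeneous : ∀ p q u → Q.quartic (p ℚ.* u) (q ℚ.* u) ≡ Q.quartic p q ℚ.* (u ℚ.* u ℚ.* u ℚ.* u)
  homogeneous = ℚSolver.solve 3 (λ p q u →
    S.quartic (p ⊗ u) (q ⊗ u) ℚSolver.⊜ S.quartic p q ⊗ (u ⊗ u ⊗ u ⊗ u)) refl
    where module S = ℚSyntax 3
  regroup : ∀ r u → r ℚ.* r ℚ.* (u ℚ.* u ℚ.* u ℚ.* u) ≡ r ℚ.* (u ℚ.* u) ℚ.* (r ℚ.* (u ℚ.* u))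
  regroup = ℚSolver.solve 2 (λ r u →
    r ⊗ r ⊗ (u ⊗ u ⊗ u ⊗ u) ℚSolver.⊜ r ⊗ (u ⊗ u) ⊗ (r ⊗ (u ⊗ u))) refl

quotient-point : ∀ {p q r} → q ≢ 0ℤ → quartic p q ≡ r * r →
                 ∃ λ xy → OnCurve xy × ↥ proj₁ xy * q ≡ p * ↧ proj₁ xy
quotient-point {p} {q} {r} q≢0 quartic≡r² = (X , Y) , onCurve , ↥x*q≡p*↧x X {p} {q} X*q≡p
  where
  instance
    q≢0ℚ : ℚ.NonZero (fromℤ q)
    q≢0ℚ = ℚ.≢-nonZero (fromℤ-≢0 q≢0)
  u = ℚ.1/ fromℤ q
  X = fromℤ p ℚ.* u
  Y = fromℤ r ℚ.* (u ℚ.* u)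
  onCurve : OnCurve (X , Y)
  onCurve = onCurve-quotient {fromℤ p} {fromℤ q} {fromℤ r} {u} (ℚ.*-inverseʳ (fromℤ q))
    (trans (sym (fromℤ-quartic p q)) (trans (cong fromℤ quartic≡r²) (fromℤ-* r r)))
  X*q≡p : X ℚ.* fromℤ q ≡ fromℤ p
  X*q≡p = trans (ℚ.*-assoc (fromℤ p) u (fromℤ q))
            (trans (cong (fromℤ p ℚ.*_) (ℚ.*-inverseˡ (fromℤ q))) (ℚ.*-identityʳ (fromℤ p)))

level⇒large-point : ∀ {k} P → OnWeierstrass P → Level k P →
                    ∃ λ xy → OnCurve xy × 2 ^ k ℕ.≤ ∣ ↥ proj₁ xy ∣
level⇒large-point {k} ⟨ m , _ , n ⟩ onW (odd-m , odd-n , h , odd-h , refl) =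
  let xy , onCurve , cross = quotient-point {xNumerator m G} {q} {yNumerator m G n}
                               (odd⇒≢0 odd-q) (onWeierstrass⇒quartic {m} {G} {n} onW)
      d = ↧ proj₁ xy
  in xy , onCurve , 2^k≤∣x∣ k {↥ proj₁ xy} {q} {w} {d} odd-q w≢0 (λ ())
                      (trans cross (factorise (+ (2 ^ k)) h s d))
  where
  G = + (2 ^ k) * h
  s = m + + 28 * (G * G)
  q = xDenominator m G n
  w = + 8 * (h * s)
  odd-q : Odd q
  odd-q = odd+even (odd+even odd-n (even* (+ 1 , refl) (m * G))) (even* (+ 32 , refl) (G * G * G))
  odd-s : Odd s
  odd-s = odd+even odd-m (even* (+ 14 , refl) (G * G))
  w≢0 : w ≢ 0ℤ
  w≢0 = *-≢0 (+ 8) (h * s) (λ ()) (*-≢0 h s (odd⇒≢0 odd-h) (odd⇒≢0 odd-s))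
  factorise : ∀ t h s d → + 8 * (t * h * s) * d ≡ t * (+ 8 * (h * s)) * d
  factorise = solve-∀

numeratorBound : List (ℚ × ℚ) → ℕ
numeratorBound []              = 0
numeratorBound ((x , _) ∷ xys) = ∣ ↥ x ∣ ℕ.+ numeratorBound xys

∈⇒≤numeratorBound : ∀ {xy xys} → xy ∈ xys → ∣ ↥ proj₁ xy ∣ ℕ.≤ numeratorBound xys
∈⇒≤numeratorBound (here refl)                   = ℕ.m≤m+n _ _
∈⇒≤numeratorBound {xys = _ ∷ _} (there xy∈xys) =
  ℕ.≤-trans (∈⇒≤numeratorBound xy∈xys) (ℕ.m≤n+m _ _)

theorem1 : Infinite OnCurve
theorem1 xys =
  let k = numeratorBound xys
      xy , onCurve , large =
        level⇒large-point {k} (pointAt k) (pointAt-onWeierstrass k) (pointAt-level k)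
  in xy , onCurve , λ xy∈xys → ℕ.<⇒≱ (ℕ.<-≤-trans (n<2^n k) large) (∈⇒≤numeratorBound xy∈xys)
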